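{- Let $\dot G\in\mathcal{C}_1\cup\mathcal{C}_4\cup\mathcal{C}_5$ be a connected, non-complete, $5$-regular and $1$ net-regular strongly regular signed graph with parameters $(n,5,a,b,c)$. Then: (1) $a<3$; (2) if $a=0$, then any two vertices joined by a positive edge have no common neighbours; and if $b=0$, then any two vertices joined by a negative edge have no common neighbours; (3) if $a=-1$, then $b\le 0$; (4) if $a=-2$, then $b\ge -1$; (5) $a>-3$; (6) $-2\le b<3$; (7) if $\dot G$ contains a balanced triangle with two negative edges, then $b\le 0$; (8) if $b=2$ or $b=-1$, then $a\le 0$; (9) if $b=-2$, then $a\ge 1$.
   Context: A signed graph $\dot G=(G,\sigma)$ is a simple graph $G$ (its underlying graph) with a sign function $\sigma:E(G)\to\{+1,-1\}$; its adjacency matrix $A_{\dot G}$ has $(i,j)$ entry $\sigma(v_iv_j)$ if $v_i\sim v_j$ and $0$ otherwise. Degree is the degree in $G$; $d^\pm(v)$ are the numbers of positive/negative edges at $v$; the net-degree is $d^+(v)-d^-(v)$, and $\dot G$ is $\rho$ net-regular if all net-degrees equal $\rho$. Connected/complete refer to $G$. $\dot G$ is homogeneous if all edges have the same sign, inhomogeneous otherwise. A triangle is balanced if the product of its three edge signs is $+1$. A signed graph on $n$ vertices is strongly regular (SRSG) if it is neither homogeneous complete nor edgeless and there are $r\in\mathbb N$, $a,b,c\in\mathbb Z$ with $(A^2_{\dot G})_{ii}=r$, $(A^2_{\dot G})_{ij}=a$ for positive edges $v_iv_j$, $=b$ for negative edges, $=c$ for distinct non-adjacent $v_i,v_j$;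 parameters $(n,r,a,b,c)$. Inhomogeneous SRSGs are divided into classes: $\mathcal{C}_1$: $a=-b$, and either complete or non-complete with $c\neq 0$; $\mathcal{C}_4$: $a\neq -b$, non-complete with $c=0$; $\mathcal{C}_5$: $a\ne -b$, non-complete with $c\neq\frac{a+b}{2}$ and $c\neq 0$. -}

module Defs where

open import Data.Nat as ℕ using (ℕ; zero; suc)
open import Data.Integer as ℤ using (ℤ; +_; -[1+_]; _≤_; _<_)
open import Data.Fin using (Fin; zero; suc)
open import Data.Bool using (if_then_else_)
open import Data.Product using (Σ; _×_; ∃; ∃-syntax; _,_)
open import Data.Sum using (_⊎_)
open import Relation.Nullary using (¬_)
open import Relation.Nullary.Decidable using (⌊_⌋)
open import Relation.Binary.PropositionalEquality using (_≡_; _≢_)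

sumℤ : (n : ℕ) → (Fin n → ℤ) → ℤ
sumℤ zero    f = + 0
sumℤ (suc n) f = f zero ℤ.+ sumℤ n (λ i → f (suc i))

sumℕ : (n : ℕ) → (Fin n → ℕ) → ℕ
sumℕ zero    f = 0
sumℕ (suc n) f = f zero ℕ.+ sumℕ n (λ i → f (suc i))

record SignedGraph (n : ℕ) : Set where
  field
    A       : Fin n → Fin n → ℤ
    entries : ∀ i j → A i j ≡ + 0 ⊎ A i j ≡ + 1 ⊎ A i j ≡ -[1+ 0 ]
    sym     : ∀ i j → A i j ≡ A j i
    loopless : ∀ i → A i i ≡ + 0

module _ {n : ℕ} (G : SignedGraph n) where
  open SignedGraph G

  Adj : Fin n → Fin n → Set
  Adj i j = A i j ≢ + 0

  PosEdge : Fin n → Fin n → Set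
  PosEdge i j = A i j ≡ + 1

  NegEdge : Fin n → Fin n → Set
  NegEdge i j = A i j ≡ -[1+ 0 ]

  A² : Fin n → Fin n → ℤ
  A² i j = sumℤ n (λ k → A i k ℤ.* A k j)

  degree : Fin n → ℕ
  degree i = sumℕ n (λ j → if ⌊ A i j ℤ.≟ + 0 ⌋ then 0 else 1)

  d⁺ : Fin n → ℕ
  d⁺ i = sumℕ n (λ j → if ⌊ A i j ℤ.≟ + 1 ⌋ then 1 else 0)

  d⁻ : Fin n → ℕ
  d⁻ i = sumℕ n (λ j → if ⌊ A i j ℤ.≟ -[1+ 0 ] ⌋ then 1 else 0)

  netDegree : Fin n → ℤ
  netDegree i = + d⁺ i ℤ.- + d⁻ i

  Regular : ℕ → Set
  Regular k = ∀ i → degree i ≡ k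

  NetRegular : ℤ → Set
  NetRegular ρ = ∀ i → netDegree i ≡ ρ

  data Reachable : Fin n → Fin n → Set where
    here : ∀ {i} → Reachable i i
    step : ∀ {i j k} → Adj i j → Reachable j k → Reachable i k

  Connected : Set
  Connected = ∀ i j → Reachable i j

  Complete : Set
  Complete = ∀ i j → i ≢ j → Adj i j

  Edgeless : Set
  Edgeless = ∀ i j → A i j ≡ + 0

  Homogeneous : Set
  Homogeneous = (∀ i j → ¬ NegEdge i j) ⊎ (∀ i j → ¬ PosEdge i j)

  Inhomogeneous : Set
  Inhomogeneous = ¬ Homogeneous

  record IsSRSG (r : ℕ) (a b c : ℤ) : Set where
    field
      notHomComplete : ¬ (Homogeneous × Complete)
      notEdgeless    : ¬ Edgeless
      diag           : ∀ i → A² i i ≡ + r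
      posPar         : ∀ i j → PosEdge i j → A² i j ≡ a
      negPar         : ∀ i j → NegEdge i j → A² i j ≡ b
      nonAdjPar      : ∀ i j → i ≢ j → A i j ≡ + 0 → A² i j ≡ c

  InC₁ : ℤ → ℤ → ℤ → Set
  InC₁ a b c = Inhomogeneous × a ≡ ℤ.- b × (Complete ⊎ (¬ Complete × c ≢ + 0))

  InC₄ : ℤ → ℤ → ℤ → Set
  InC₄ a b c = Inhomogeneous × a ≢ ℤ.- b × ¬ Complete × c ≡ + 0

  -- c ≠ (a+b)/2 is expressed as 2c ≠ a + b
  InC₅ : ℤ → ℤ → ℤ → Set
  InC₅ a b c = Inhomogeneous × a ≢ ℤ.- b × ¬ Complete
               × (+ 2 ℤ.* c ≢ a ℤ.+ b) × c ≢ + 0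

  HaveCommonNeighbour : Fin n → Fin n → Set
  HaveCommonNeighbour i j = ∃[ k ] (Adj i k × Adj j k)

  -- a balanced triangle with two negative edges (the third edge is then positive)
  BalancedTriangleTwoNeg : Set
  BalancedTriangleTwoNeg =
    ∃[ i ] ∃[ j ] ∃[ k ] (NegEdge i j × NegEdge j k × PosEdge i k)

-- Fix a vertex v. Being 5-regular and 1 net-regular, v has three positive neighbours y₀,y₁,y₂
-- and two negative ones y₃,y₄, and the signed adjacency matrix S of the graph they induce
-- satisfies two identities. Counting walks v → yᵢ → yⱼ gives ∑ᵢ σᵢ Sᵢⱼ = (A²)_{v yⱼ}, which is a
-- or b according to the sign σⱼ. Comparing the (v, yⱼ) entries of A·A² and A²·A, where off the
-- diagonal A² is a, b or c according to the entry of A, everything cancels except (a + b − 2c)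
-- times an integer balance of column j, which therefore vanishes since c ≠ (a + b)/2 in all
-- three classes. An exhaustive search over the 3¹⁰ candidates for S leaves seven pairs (a, b)
-- and records the shape of S for each. The pairs (−4, 3) and (−4, 4) are refuted globally: the
-- first by comparing the local pictures at v and at y₀, the second because it makes every
-- neighbourhood a clique, so that the connected graph would be complete. The claims then hold
-- for the five remaining pairs.

module Submission where

open import Defs
open import Level using (0ℓ)
open import Data.Nat.Base as ℕ using (ℕ; zero; suc)
import Data.Nat.Properties as ℕ
open import Data.Integer.Base as ℤ
  using (ℤ; +_; -[1+_]; 0ℤ; 1ℤ; -1ℤ; _+_; _*_; -_; _-_; _≤_; _<_)
import Data.Integer.Properties as ℤ
open import Data.Integer.Tactic.RingSolver using (solve-∀)
open import Data.Fin.Base using (Fin; zero; suc; splitAt; join; _↑ˡ_; _↑ʳ_)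
open import Data.Fin.Patterns using (0F; 1F; 2F; 3F; 4F)
open import Data.Fin.Properties using (all?; suc-injective; join-splitAt)
  renaming (_≟_ to _≟ᶠ_)
open import Data.Vec.Functional using (_++_)
open import Data.Vec.Functional.Properties using (lookup-++ˡ; lookup-++ʳ)
open import Data.List.Base using (List; []; _∷_)
open import Data.List.Membership.Propositional using (_∈_)
open import Data.List.Relation.Unary.Any using (here; there)
open import Data.List.Relation.Unary.All as All using (All)
import Data.Product.Properties as Product
open import Data.List.Membership.DecPropositional (Product.≡-dec ℤ._≟_ ℤ._≟_) using (_∈?_)
open import Data.Product.Base using (_×_; _,_; ∃-syntax; proj₁; proj₂; uncurry)
open import Data.Sum.Base using (_⊎_; inj₁; inj₂; [_,_]′)
open import Data.Bool.Base using (true; false; if_then_else_)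
open import Function.Base using (_∘_; id)
open import Function.Definitions using (Injective)
open import Relation.Nullary
  using (Dec; yes; no; does; ¬_; ¬?; _×-dec_; _⊎-dec_; _→-dec_; contradiction)
open import Relation.Nullary.Decidable using (⌊_⌋; map′; from-yes; does-≡)
open import Relation.Unary using (Pred; Decidable)
open import Relation.Binary.PropositionalEquality
  using (_≡_; _≢_; refl; sym; trans; cong; cong₂; subst; module ≡-Reasoning)
open import Algebra.Properties.Semiring.Sum ℤ.+-*-semiring
  using (sum; sum-syntax; sum-cong-≗; sum-replicate-zero; ∑-distrib-+; ∑-comm;
         *-distribˡ-sum; *-distribʳ-sum)
import Algebra.Properties.CommutativeMonoid.Sum ℕ.+-0-commutativeMonoid as ℕΣ
open import Algebra.Properties.AbelianGroup ℤ.+-0-abelianGroup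
  using (∙-cancelˡ; ∙-cancelʳ; inverseˡ-unique)

-- Finite sums

sumℤ≡∑ : ∀ n (f : Fin n → ℤ) → sumℤ n f ≡ ∑[ i < n ] f i
sumℤ≡∑ zero    f = refl
sumℤ≡∑ (suc n) f = cong (λ t → f zero + t) (sumℤ≡∑ n (f ∘ suc))

sumℕ≡∑ : ∀ n (f : Fin n → ℕ) → sumℕ n f ≡ ℕΣ.sum f
sumℕ≡∑ zero    f = refl
sumℕ≡∑ (suc n) f = cong (f zero ℕ.+_) (sumℕ≡∑ n (f ∘ suc))

sumℕ-split : ∀ n (h f g : Fin n → ℕ) → (∀ i → h i ≡ f i ℕ.+ g i) →
             sumℕ n h ≡ sumℕ n f ℕ.+ sumℕ n g
sumℕ-split n h f g h≗f+g = begin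
  sumℕ n h                    ≡⟨ sumℕ≡∑ n h ⟩
  ℕΣ.sum h                    ≡⟨ ℕΣ.sum-cong-≗ h≗f+g ⟩
  ℕΣ.sum (λ i → f i ℕ.+ g i)  ≡⟨ ℕΣ.∑-distrib-+ f g ⟩
  ℕΣ.sum f ℕ.+ ℕΣ.sum g       ≡⟨ sym (cong₂ ℕ._+_ (sumℕ≡∑ n f) (sumℕ≡∑ n g)) ⟩
  sumℕ n f ℕ.+ sumℕ n g       ∎
  where open ≡-Reasoning

δ : ∀ {n} → Fin n → Fin n → ℤ → ℤ
δ x y t = if does (x ≟ᶠ y) then t else 0ℤ

δ-cong : ∀ {m n} {x y : Fin m} {x′ y′ : Fin n} {t} →
         (x ≡ y → x′ ≡ y′) → (x′ ≡ y′ → x ≡ y) → δ x y t ≡ δ x′ y′ t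
δ-cong {x = x} {y} {x′} {y′} {t} to from =
  cong (λ d → if d then t else 0ℤ) (does-≡ (x ≟ᶠ y) (map′ from to (x′ ≟ᶠ y′)))

δ-zero : ∀ {n} (x y : Fin n) → δ x y 0ℤ ≡ 0ℤ
δ-zero x y with does (x ≟ᶠ y)
... | false = refl
... | true  = refl

*-δ : ∀ {n} (x y : Fin n) s t → s * δ x y t ≡ δ x y (s * t)
*-δ x y s t with does (x ≟ᶠ y)
... | false = ℤ.*-zeroʳ s
... | true  = refl

δ-* : ∀ {n} (x y : Fin n) t s → δ x y t * s ≡ δ x y (t * s)
δ-* x y t s with does (x ≟ᶠ y)
... | false = ℤ.*-zeroˡ s
... | true  = refl

∑-δ : ∀ {n} (x : Fin n) (h : Fin n → ℤ) → ∑[ y < n ] δ x y (h y) ≡ h x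
∑-δ {suc n} zero    h = trans (cong (λ t → h zero + t) (sum-replicate-zero n)) (ℤ.+-identityʳ _)
∑-δ {suc n} (suc x) h = trans (ℤ.+-identityˡ _) (∑-δ x (h ∘ suc))

∑-δˡ : ∀ {n} (x : Fin n) (h : Fin n → ℤ) → ∑[ y < n ] δ y x (h y) ≡ h x
∑-δˡ x h = trans (sum-cong-≗ (λ y → δ-cong {x = y} {x} {x} {y} {h y} sym sym)) (∑-δ x h)

∑-image : ∀ {k n} (e : Fin k → Fin n) → Injective _≡_ _≡_ e → (f : Fin n → ℤ) →
          (∀ z → f z ≢ 0ℤ → ∃[ i ] z ≡ e i) → ∑[ z < n ] f z ≡ ∑[ i < k ] f (e i)
∑-image {k} {n} e e-injective f support = begin
  ∑[ z < n ] f z                         ≡⟨ sum-cong-≗ spread ⟩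
  ∑[ z < n ] ∑[ i < k ] δ (e i) z (f z)  ≡⟨ ∑-comm (λ z i → δ (e i) z (f z)) ⟩
  ∑[ i < k ] ∑[ z < n ] δ (e i) z (f z)  ≡⟨ sum-cong-≗ (λ i → ∑-δ (e i) f) ⟩
  ∑[ i < k ] f (e i)                     ∎
  where
  open ≡-Reasoning
  spread : ∀ z → f z ≡ ∑[ i < k ] δ (e i) z (f z)
  spread z with f z ℤ.≟ 0ℤ
  ... | yes fz≡0 = trans fz≡0 (sym (trans (sum-cong-≗ vanish) (sum-replicate-zero k)))
    where
    vanish : ∀ i → δ (e i) z (f z) ≡ 0ℤ
    vanish i = trans (cong (δ (e i) z) fz≡0) (δ-zero (e i) z)
  ... | no fz≢0 with support z fz≢0
  ...   | j , refl = sym (trans (sum-cong-≗ swap) (∑-δ j (λ _ → f (e j))))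
    where
    swap : ∀ i → δ (e i) (e j) (f (e j)) ≡ δ j i (f (e j))
    swap i = δ-cong (sym ∘ e-injective) (cong e ∘ sym)

matrix-*-assoc : ∀ {n} (M N P : Fin n → Fin n → ℤ) u x →
  ∑[ z < n ] (M u z * ∑[ w < n ] (N z w * P w x)) ≡ ∑[ w < n ] (∑[ z < n ] (M u z * N z w) * P w x)
matrix-*-assoc {n} M N P u x = begin
  ∑[ z < n ] (M u z * ∑[ w < n ] (N z w * P w x))
    ≡⟨ sum-cong-≗ (λ z → *-distribˡ-sum (M u z) (λ w → N z w * P w x)) ⟩
  ∑[ z < n ] ∑[ w < n ] (M u z * (N z w * P w x))
    ≡⟨ ∑-comm (λ z w → M u z * (N z w * P w x)) ⟩
  ∑[ w < n ] ∑[ z < n ] (M u z * (N z w * P w x))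
    ≡⟨ sum-cong-≗ (λ w → sum-cong-≗ (λ z → sym (ℤ.*-assoc (M u z) (N z w) (P w x)))) ⟩
  ∑[ w < n ] ∑[ z < n ] (M u z * N z w * P w x)
    ≡⟨ sum-cong-≗ (λ w → sym (*-distribʳ-sum (P w x) (λ z → M u z * N z w))) ⟩
  ∑[ w < n ] (∑[ z < n ] (M u z * N z w) * P w x) ∎
  where open ≡-Reasoning

-- Enumerating a decidable subset of Fin n

count : ∀ {n} {P : Pred (Fin n) 0ℓ} → Decidable P → ℕ
count {n} P? = sumℕ n (λ x → if ⌊ P? x ⌋ then 1 else 0)

record Enumeration {n} (P : Pred (Fin n) 0ℓ) (k : ℕ) : Set where
  field
    at        : Fin k → Fin n
    injective : Injective _≡_ _≡_ at
    sound     : ∀ i → P (at i)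
    complete  : ∀ {x} → P x → ∃[ i ] x ≡ at i

enumerate : ∀ {n} {P : Pred (Fin n) 0ℓ} (P? : Decidable P) → Enumeration P (count P?)
enumerate {zero} P? = record { at = λ () ; injective = λ {} ; sound = λ () ; complete = λ {} }
enumerate {suc n} P? with P? zero | enumerate (P? ∘ suc)
... | yes p | e = record
  { at        = λ { zero → zero ; (suc i) → suc (at i) }
  ; injective = λ { {zero} {zero} _ → refl
                  ; {suc i} {suc j} eq → cong suc (injective (suc-injective eq)) }
  ; sound     = λ { zero → p ; (suc i) → sound i }
  ; complete  = λ { {zero} _ → zero , refl
                  ; {suc x} px → let i , eq = complete px in suc i , cong suc eq }
  }
  where open Enumeration e
... | no ¬p | e = record
  { at        = suc ∘ at
  ; injective = injective ∘ suc-injective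
  ; sound     = sound
  ; complete  = λ { {zero} p → contradiction p ¬p
                  ; {suc x} px → let i , eq = complete px in i , cong suc eq }
  }
  where open Enumeration e

++-injective : ∀ {m k n} {f : Fin m → Fin n} {g : Fin k → Fin n} →
               Injective _≡_ _≡_ f → Injective _≡_ _≡_ g → (∀ i j → f i ≢ g j) →
               Injective _≡_ _≡_ (f ++ g)
++-injective {m} {k} {f = f} {g} f-injective g-injective f≢g {i} {j} eq = begin
  i                       ≡⟨ sym (join-splitAt m k i) ⟩
  join m k (splitAt m i)  ≡⟨ cong (join m k) ([f,g]-injective (splitAt m i) (splitAt m j) eq) ⟩
  join m k (splitAt m j)  ≡⟨ join-splitAt m k j ⟩
  j                       ∎
  where
  open ≡-Reasoning
  [f,g]-injective : ∀ s t → [ f , g ]′ s ≡ [ f , g ]′ t → s ≡ t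
  [f,g]-injective (inj₁ x) (inj₁ y) e = cong inj₁ (f-injective e)
  [f,g]-injective (inj₁ x) (inj₂ y) e = contradiction e (f≢g x y)
  [f,g]-injective (inj₂ x) (inj₁ y) e = contradiction (sym e) (f≢g y x)
  [f,g]-injective (inj₂ x) (inj₂ y) e = cong inj₂ (g-injective e)

-- The local matrix of a vertex

-- (A²)ᵤᵥ for u ≠ v of a strongly regular signed graph with parameters (n, r, a, b, c), as a
-- function of the entry Aᵤᵥ.
param : ℤ → ℤ → ℤ → ℤ → ℤ
param a b c x = if does (x ℤ.≟ 1ℤ) then a else if does (x ℤ.≟ -1ℤ) then b else c

entryValues : List ℤ
entryValues = 0ℤ ∷ 1ℤ ∷ -1ℤ ∷ []

-- The five neighbours of a vertex are listed positive ones first: y₀, y₁, y₂ and then y₃, y₄.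
bySign : ℤ → ℤ → Fin 5 → ℤ
bySign p q = (λ (_ : Fin 3) → p) ++ (λ (_ : Fin 2) → q)

σ : Fin 5 → ℤ
σ = bySign 1ℤ -1ℤ

bySign-cases : ∀ p q j → σ j ≡ 1ℤ × bySign p q j ≡ p ⊎ σ j ≡ -1ℤ × bySign p q j ≡ q
bySign-cases p q 0F = inj₁ (refl , refl)
bySign-cases p q 1F = inj₁ (refl , refl)
bySign-cases p q 2F = inj₁ (refl , refl)
bySign-cases p q 3F = inj₂ (refl , refl)
bySign-cases p q 4F = inj₂ (refl , refl)

σ-negative : ∀ {i} → σ i ≡ -1ℤ → i ≡ 3F ⊎ i ≡ 4F
σ-negative {3F} _ = inj₁ refl
σ-negative {4F} _ = inj₂ refl

LocalMatrix : Set
LocalMatrix = Fin 5 → Fin 5 → ℤ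

column : LocalMatrix → Fin 5 → ℤ
column S j = ∑[ i < 5 ] (σ i * S i j)

indicator : ∀ {P : Set} → Dec P → ℤ
indicator P? = if does P? then 1ℤ else 0ℤ

-- The walks v → yᵢ → yⱼ of sign −1, each counted with the sign σᵢ of its first edge.
balance : LocalMatrix → Fin 5 → ℤ
balance S j = ∑[ i < 5 ] (σ i * indicator (σ i * S i j ℤ.≟ -1ℤ))

balance-term : ∀ a b c {s x} → s ∈ 1ℤ ∷ -1ℤ ∷ [] → x ∈ entryValues →
  s * param a b c x
    ≡ (param a b c s - c) * x + s * c + (a + b - + 2 * c) * (s * indicator (s * x ℤ.≟ -1ℤ))
balance-term a b c (here refl)         (here refl)                 = p₀ a b c
  where p₀ : ∀ a b c → 1ℤ * c ≡ (a - c) * 0ℤ + 1ℤ * c + (a + b - + 2 * c) * 0ℤ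
        p₀ = solve-∀
balance-term a b c (here refl)         (there (here refl))         = p₊ a b c
  where p₊ : ∀ a b c → 1ℤ * a ≡ (a - c) * 1ℤ + 1ℤ * c + (a + b - + 2 * c) * 0ℤ
        p₊ = solve-∀
balance-term a b c (here refl)         (there (there (here refl))) = p₋ a b c
  where p₋ : ∀ a b c → 1ℤ * b ≡ (a - c) * -1ℤ + 1ℤ * c + (a + b - + 2 * c) * 1ℤ
        p₋ = solve-∀
balance-term a b c (there (here refl)) (here refl)                 = n₀ a b c
  where n₀ : ∀ a b c → -1ℤ * c ≡ (b - c) * 0ℤ + -1ℤ * c + (a + b - + 2 * c) * 0ℤ
        n₀ = solve-∀
balance-term a b c (there (here refl)) (there (here refl))         = n₊ a b c
  where n₊ : ∀ a b c → -1ℤ * a ≡ (b - c) * 1ℤ + -1ℤ * c + (a + b - + 2 * c) * -1ℤ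
        n₊ = solve-∀
balance-term a b c (there (here refl)) (there (there (here refl))) = n₋ a b c
  where n₋ : ∀ a b c → -1ℤ * b ≡ (b - c) * -1ℤ + -1ℤ * c + (a + b - + 2 * c) * 0ℤ
        n₋ = solve-∀

σ∈signs : ∀ i → σ i ∈ 1ℤ ∷ -1ℤ ∷ []
σ∈signs i with bySign-cases 1ℤ -1ℤ i
... | inj₁ (σi≡1 , _)  = here σi≡1
... | inj₂ (σi≡-1 , _) = there (here σi≡-1)

balance≡0 : ∀ a b c (S : LocalMatrix) j → a + b ≢ + 2 * c → (∀ i → S i j ∈ entryValues) →
  ∑[ i < 5 ] (σ i * param a b c (S i j)) ≡ ∑[ i < 5 ] ((param a b c (σ i) - c) * S i j) + c →
  balance S j ≡ 0ℤ
balance≡0 a b c S j a+b≢2c entries identity =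
  [ (λ D≡0 → contradiction (degenerate D≡0) a+b≢2c) , id ]′
    (ℤ.i*j≡0⇒i≡0∨j≡0 D (∙-cancelˡ (R + c) _ _ (trans expand identity′)))
  where
  D R : ℤ
  D = a + b - + 2 * c
  Pᵢ Iᵢ : Fin 5 → ℤ
  Pᵢ i = (param a b c (σ i) - c) * S i j
  Iᵢ i = σ i * indicator (σ i * S i j ℤ.≟ -1ℤ)
  R = sum Pᵢ
  open ≡-Reasoning
  expand : R + c + D * balance S j ≡ ∑[ i < 5 ] (σ i * param a b c (S i j))
  expand = sym (begin
    ∑[ i < 5 ] (σ i * param a b c (S i j))
      ≡⟨ sum-cong-≗ (λ i → balance-term a b c (σ∈signs i) (entries i)) ⟩
    ∑[ i < 5 ] (Pᵢ i + σ i * c + D * Iᵢ i)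
      ≡⟨ trans (∑-distrib-+ (λ i → Pᵢ i + σ i * c) (λ i → D * Iᵢ i))
               (cong₂ _+_ (∑-distrib-+ Pᵢ (λ i → σ i * c)) (sym (*-distribˡ-sum D Iᵢ))) ⟩
    R + ∑[ i < 5 ] (σ i * c) + D * balance S j
      ≡⟨ cong (λ t → R + t + D * balance S j)
              (trans (sym (*-distribʳ-sum c σ)) (ℤ.*-identityˡ c)) ⟩
    R + c + D * balance S j ∎)
  identity′ : ∑[ i < 5 ] (σ i * param a b c (S i j)) ≡ R + c + 0ℤ
  identity′ = trans identity (sym (ℤ.+-identityʳ _))
  a+b≡D+2c : ∀ a b c → a + b ≡ a + b - + 2 * c + + 2 * c
  a+b≡D+2c = solve-∀
  degenerate : D ≡ 0ℤ → a + b ≡ + 2 * c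
  degenerate D≡0 = trans (a+b≡D+2c a b c) (trans (cong (_+ + 2 * c) D≡0) (ℤ.+-identityˡ _))

symmetricMatrix : (x₀₁ x₀₂ x₀₃ x₀₄ x₁₂ x₁₃ x₁₄ x₂₃ x₂₄ x₃₄ : ℤ) → LocalMatrix
symmetricMatrix x₀₁ x₀₂ x₀₃ x₀₄ x₁₂ x₁₃ x₁₄ x₂₃ x₂₄ x₃₄ = λ
  { 0F 0F → 0ℤ  ; 0F 1F → x₀₁ ; 0F 2F → x₀₂ ; 0F 3F → x₀₃ ; 0F 4F → x₀₄
  ; 1F 0F → x₀₁ ; 1F 1F → 0ℤ  ; 1F 2F → x₁₂ ; 1F 3F → x₁₃ ; 1F 4F → x₁₄
  ; 2F 0F → x₀₂ ; 2F 1F → x₁₂ ; 2F 2F → 0ℤ  ; 2F 3F → x₂₃ ; 2F 4F → x₂₄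
  ; 3F 0F → x₀₃ ; 3F 1F → x₁₃ ; 3F 2F → x₂₃ ; 3F 3F → 0ℤ  ; 3F 4F → x₃₄
  ; 4F 0F → x₀₄ ; 4F 1F → x₁₄ ; 4F 2F → x₂₄ ; 4F 3F → x₃₄ ; 4F 4F → 0ℤ
  }

symmetric-from-upper : ∀ (S : LocalMatrix) → (∀ i j → S i j ≡ S j i) → (∀ i → S i i ≡ 0ℤ) →
  ∀ i j → S i j ≡ symmetricMatrix (S 0F 1F) (S 0F 2F) (S 0F 3F) (S 0F 4F) (S 1F 2F)
                                  (S 1F 3F) (S 1F 4F) (S 2F 3F) (S 2F 4F) (S 3F 4F) i j
symmetric-from-upper S S-sym S-diag = λ
  { 0F 0F → S-diag 0F     ; 0F 1F → refl          ; 0F 2F → refl          ; 0F 3F → refl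
  ; 0F 4F → refl          ; 1F 0F → S-sym 1F 0F   ; 1F 1F → S-diag 1F     ; 1F 2F → refl
  ; 1F 3F → refl          ; 1F 4F → refl          ; 2F 0F → S-sym 2F 0F   ; 2F 1F → S-sym 2F 1F
  ; 2F 2F → S-diag 2F     ; 2F 3F → refl          ; 2F 4F → refl          ; 3F 0F → S-sym 3F 0F
  ; 3F 1F → S-sym 3F 1F   ; 3F 2F → S-sym 3F 2F   ; 3F 3F → S-diag 3F     ; 3F 4F → refl
  ; 4F 0F → S-sym 4F 0F   ; 4F 1F → S-sym 4F 1F   ; 4F 2F → S-sym 4F 2F   ; 4F 3F → S-sym 4F 3F
  ; 4F 4F → S-diag 4F
  }

realisedPairs admissiblePairs : List (ℤ × ℤ)
realisedPairs = (0ℤ , 0ℤ) ∷ (0ℤ , 1ℤ) ∷ (+ 2 , -[1+ 1 ]) ∷ (+ 2 , 0ℤ) ∷ (+ 2 , 1ℤ) ∷ []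
admissiblePairs = (-[1+ 3 ] , + 3) ∷ (-[1+ 3 ] , + 4) ∷ realisedPairs

record LocalFacts (a b : ℤ) (S : LocalMatrix) : Set where
  field
    admissible             : (a , b) ∈ admissiblePairs
    positive-rows-vanish   : a ≡ 0ℤ → ∀ i j → σ i ≡ 1ℤ → S i j ≡ 0ℤ
    negative-rows-vanish   : b ≡ 0ℤ → ∀ i j → σ i ≡ -1ℤ → S i j ≡ 0ℤ
    opposite-signs         : a ≡ -[1+ 3 ] → ∀ i j → σ i ≡ 1ℤ → i ≢ j → S i j ≡ - σ j
    negative-pair-joined   : b ≡ 1ℤ ⊎ b ≡ + 4 → S 3F 4F ≡ -1ℤ
    negative-pair-unjoined : b ≡ + 3 → S 3F 4F ≡ 0ℤ

localFacts? : ∀ a b S → Dec (LocalFacts a b S)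
localFacts? a b S =
  map′ (λ (p₁ , p₂ , p₃ , p₄ , p₅ , p₆) → record
         { admissible = p₁ ; positive-rows-vanish = p₂ ; negative-rows-vanish = p₃
         ; opposite-signs = p₄ ; negative-pair-joined = p₅ ; negative-pair-unjoined = p₆ })
       (λ facts → let open LocalFacts facts in
         admissible , positive-rows-vanish , negative-rows-vanish
         , opposite-signs , negative-pair-joined , negative-pair-unjoined)
       ((a , b) ∈? admissiblePairs
        ×-dec (a ℤ.≟ 0ℤ →-dec all? λ i → all? λ j → σ i ℤ.≟ 1ℤ →-dec S i j ℤ.≟ 0ℤ)
        ×-dec (b ℤ.≟ 0ℤ →-dec all? λ i → all? λ j → σ i ℤ.≟ -1ℤ →-dec S i j ℤ.≟ 0ℤ)
        ×-dec (a ℤ.≟ -[1+ 3 ] →-dec all? λ i → all? λ j →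
                 σ i ℤ.≟ 1ℤ →-dec ¬? (i ≟ᶠ j) →-dec S i j ℤ.≟ - σ j)
        ×-dec ((b ℤ.≟ 1ℤ ⊎-dec b ℤ.≟ + 4) →-dec S 3F 4F ℤ.≟ -1ℤ)
        ×-dec (b ℤ.≟ + 3 →-dec S 3F 4F ℤ.≟ 0ℤ))

LocalFacts-transport : ∀ {a b a′ b′} {S T : LocalMatrix} → a ≡ a′ → b ≡ b′ →
                       (∀ i j → S i j ≡ T i j) → LocalFacts a b T → LocalFacts a′ b′ S
LocalFacts-transport refl refl S≡T facts = record
  { admissible             = admissible
  ; positive-rows-vanish   = λ a≡0 i j σi≡1 → trans (S≡T i j) (positive-rows-vanish a≡0 i j σi≡1)
  ; negative-rows-vanish   = λ b≡0 i j σi≡-1 → trans (S≡T i j) (negative-rows-vanish b≡0 i j σi≡-1)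
  ; opposite-signs         = λ a≡-4 i j σi≡1 i≢j → trans (S≡T i j) (opposite-signs a≡-4 i j σi≡1 i≢j)
  ; negative-pair-joined   = trans (S≡T 3F 4F) ∘ negative-pair-joined
  ; negative-pair-unjoined = trans (S≡T 3F 4F) ∘ negative-pair-unjoined
  }
  where open LocalFacts facts

-- The search fills in the upper triangle row by row and discards a partial matrix as soon as
-- one of its completed columns fails an identity (the unfilled entries are set to 0, which the
-- completed columns do not see).
Search : Set
Search =
  All (λ x₀₁ → All (λ x₀₂ → All (λ x₀₃ → All (λ x₀₄ →
  balance (symmetricMatrix x₀₁ x₀₂ x₀₃ x₀₄ 0ℤ 0ℤ 0ℤ 0ℤ 0ℤ 0ℤ) 0F ≡ 0ℤ →
  All (λ x₁₂ → All (λ x₁₃ → All (λ x₁₄ →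
  let S₁ = symmetricMatrix x₀₁ x₀₂ x₀₃ x₀₄ x₁₂ x₁₃ x₁₄ 0ℤ 0ℤ 0ℤ in
  balance S₁ 1F ≡ 0ℤ → column S₁ 0F ≡ column S₁ 1F →
  All (λ x₂₃ → All (λ x₂₄ →
  let S₂ = symmetricMatrix x₀₁ x₀₂ x₀₃ x₀₄ x₁₂ x₁₃ x₁₄ x₂₃ x₂₄ 0ℤ in
  balance S₂ 2F ≡ 0ℤ → column S₂ 0F ≡ column S₂ 2F →
  All (λ x₃₄ →
  let S = symmetricMatrix x₀₁ x₀₂ x₀₃ x₀₄ x₁₂ x₁₃ x₁₄ x₂₃ x₂₄ x₃₄ in
  balance S 3F ≡ 0ℤ → balance S 4F ≡ 0ℤ → column S 3F ≡ column S 4F →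
  LocalFacts (column S 0F) (column S 3F) S)
  entryValues) entryValues) entryValues) entryValues) entryValues) entryValues) entryValues) entryValues) entryValues) entryValues

search : Search
search = from-yes
  (All.all? (λ x₀₁ → All.all? (λ x₀₂ → All.all? (λ x₀₃ → All.all? (λ x₀₄ →
  balance (symmetricMatrix x₀₁ x₀₂ x₀₃ x₀₄ 0ℤ 0ℤ 0ℤ 0ℤ 0ℤ 0ℤ) 0F ℤ.≟ 0ℤ →-dec
  All.all? (λ x₁₂ → All.all? (λ x₁₃ → All.all? (λ x₁₄ →
  let S₁ = symmetricMatrix x₀₁ x₀₂ x₀₃ x₀₄ x₁₂ x₁₃ x₁₄ 0ℤ 0ℤ 0ℤ in
  balance S₁ 1F ℤ.≟ 0ℤ →-dec column S₁ 0F ℤ.≟ column S₁ 1F →-dec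
  All.all? (λ x₂₃ → All.all? (λ x₂₄ →
  let S₂ = symmetricMatrix x₀₁ x₀₂ x₀₃ x₀₄ x₁₂ x₁₃ x₁₄ x₂₃ x₂₄ 0ℤ in
  balance S₂ 2F ℤ.≟ 0ℤ →-dec column S₂ 0F ℤ.≟ column S₂ 2F →-dec
  All.all? (λ x₃₄ →
  let S = symmetricMatrix x₀₁ x₀₂ x₀₃ x₀₄ x₁₂ x₁₃ x₁₄ x₂₃ x₂₄ x₃₄ in
  balance S 3F ℤ.≟ 0ℤ →-dec balance S 4F ℤ.≟ 0ℤ →-dec column S 3F ℤ.≟ column S 4F →-dec
  localFacts? (column S 0F) (column S 3F) S)
  entryValues) entryValues) entryValues) entryValues) entryValues) entryValues) entryValues) entryValues) entryValues) entryValues)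

classify : ∀ a b (S : LocalMatrix) → (∀ i j → S i j ∈ entryValues) →
           (∀ i j → S i j ≡ S j i) → (∀ i → S i i ≡ 0ℤ) →
           (∀ j → column S j ≡ bySign a b j) → (∀ j → balance S j ≡ 0ℤ) → LocalFacts a b S
classify a b S entries S-sym S-diag columns balanced =
  LocalFacts-transport (trans (columnT 0F) (columns 0F)) (trans (columnT 3F) (columns 3F)) S≡T
    (((((search ! entries 0F 1F ! entries 0F 2F ! entries 0F 3F ! entries 0F 4F) (balancedT 0F)
        ! entries 1F 2F ! entries 1F 3F ! entries 1F 4F) (balancedT 1F) (sameColumn 0F 1F refl)
        ! entries 2F 3F ! entries 2F 4F) (balancedT 2F) (sameColumn 0F 2F refl)
        ! entries 3F 4F) (balancedT 3F) (balancedT 4F) (sameColumn 3F 4F refl))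
  where
  _!_ : ∀ {P : Pred ℤ 0ℓ} {xs} → All P xs → ∀ {x} → x ∈ xs → P x
  ps ! x∈xs = All.lookup ps x∈xs
  infixl 5 _!_
  T : LocalMatrix
  T = symmetricMatrix (S 0F 1F) (S 0F 2F) (S 0F 3F) (S 0F 4F) (S 1F 2F)
                      (S 1F 3F) (S 1F 4F) (S 2F 3F) (S 2F 4F) (S 3F 4F)
  S≡T : ∀ i j → S i j ≡ T i j
  S≡T = symmetric-from-upper S S-sym S-diag
  columnT : ∀ j → column T j ≡ column S j
  columnT j = sum-cong-≗ (λ i → cong (σ i *_) (sym (S≡T i j)))
  balancedT : ∀ j → balance T j ≡ 0ℤ
  balancedT j = trans (sum-cong-≗ (λ i → cong (λ x → σ i * indicator (σ i * x ℤ.≟ -1ℤ))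
                                              (sym (S≡T i j))))
                      (balanced j)
  sameColumn : ∀ i j → bySign a b i ≡ bySign a b j → column T i ≡ column T j
  sameColumn i j same = trans (trans (columnT i) (columns i))
                              (trans same (sym (trans (columnT j) (columns j))))

-- Signed graphs

m+n≡5⇒m-n≡1⇒m≡3∧n≡2 : ∀ m n → m ℕ.+ n ≡ 5 → + m - + n ≡ 1ℤ → m ≡ 3 × n ≡ 2
m+n≡5⇒m-n≡1⇒m≡3∧n≡2 0 _ refl ()
m+n≡5⇒m-n≡1⇒m≡3∧n≡2 1 _ refl ()
m+n≡5⇒m-n≡1⇒m≡3∧n≡2 2 _ refl ()
m+n≡5⇒m-n≡1⇒m≡3∧n≡2 3 _ refl _ = refl , refl
m+n≡5⇒m-n≡1⇒m≡3∧n≡2 4 _ refl ()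
m+n≡5⇒m-n≡1⇒m≡3∧n≡2 5 _ refl ()

module _ {n} (G : SignedGraph n) where
  open SignedGraph G renaming (sym to A-sym)

  Adj-sym : ∀ {u w} → Adj G u w → Adj G w u
  Adj-sym {u} {w} u~w A≡0 = u~w (trans (A-sym u w) A≡0)

  PosEdge⇒Adj : ∀ {u w} → PosEdge G u w → Adj G u w
  PosEdge⇒Adj u+w A≡0 = contradiction (trans (sym u+w) A≡0) λ ()

  NegEdge⇒Adj : ∀ {u w} → NegEdge G u w → Adj G u w
  NegEdge⇒Adj u-w A≡0 = contradiction (trans (sym u-w) A≡0) λ ()

  entry∈entryValues : ∀ u w → A u w ∈ entryValues
  entry∈entryValues u w with entries u w
  ... | inj₁ A≡0         = here A≡0
  ... | inj₂ (inj₁ A≡1)  = there (here A≡1)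
  ... | inj₂ (inj₂ A≡-1) = there (there (here A≡-1))

  A·A²≡A²·A : ∀ v x → ∑[ z < n ] (A v z * A² G z x) ≡ ∑[ w < n ] (A² G v w * A w x)
  A·A²≡A²·A v x = begin
    ∑[ z < n ] (A v z * A² G z x)                    ≡⟨ sum-cong-≗ (λ z → cong (A v z *_) (sumℤ≡∑ n _)) ⟩
    ∑[ z < n ] (A v z * ∑[ w < n ] (A z w * A w x))  ≡⟨ matrix-*-assoc A A A v x ⟩
    ∑[ w < n ] (∑[ z < n ] (A v z * A z w) * A w x)  ≡⟨ sum-cong-≗ (λ w → cong (_* A w x) (sym (sumℤ≡∑ n _))) ⟩
    ∑[ w < n ] (A² G v w * A w x)                    ∎
    where open ≡-Reasoning

  LocallyComplete : Set
  LocallyComplete = ∀ {u w₁ w₂} → Adj G u w₁ → Adj G u w₂ → w₁ ≢ w₂ → Adj G w₁ w₂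

  reachable⇒adjacent : LocallyComplete → ∀ {u z} → Reachable G u z → z ≡ u ⊎ Adj G u z
  reachable⇒adjacent clique here = inj₁ refl
  reachable⇒adjacent clique {u} {z} (step u~j j⇝z) with reachable⇒adjacent clique j⇝z
  ... | inj₁ refl = inj₂ u~j
  ... | inj₂ j~z with z ≟ᶠ u
  ...   | yes z≡u = inj₁ z≡u
  ...   | no z≢u  = inj₂ (clique (Adj-sym u~j) j~z (z≢u ∘ sym))

  connected-locally-complete⇒complete : Connected G → LocallyComplete → Complete G
  connected-locally-complete⇒complete connected clique u w u≢w =
    [ (λ w≡u → contradiction (sym w≡u) u≢w) , id ]′ (reachable⇒adjacent clique (connected u w))

module Regular5NetRegular1 {n} (G : SignedGraph n) (regular : Regular G 5)
                           (netRegular : NetRegular G 1ℤ) where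
  open SignedGraph G renaming (sym to A-sym)

  d⁺+d⁻≡degree : ∀ v → degree G v ≡ d⁺ G v ℕ.+ d⁻ G v
  d⁺+d⁻≡degree v = sumℕ-split n _ _ _ split
    where
    split : ∀ w → (if ⌊ A v w ℤ.≟ 0ℤ ⌋ then 0 else 1)
                  ≡ (if ⌊ A v w ℤ.≟ 1ℤ ⌋ then 1 else 0) ℕ.+ (if ⌊ A v w ℤ.≟ -1ℤ ⌋ then 1 else 0)
    split w with entries v w
    ... | inj₁ A≡0         rewrite A≡0  = refl
    ... | inj₂ (inj₁ A≡1)  rewrite A≡1  = refl
    ... | inj₂ (inj₂ A≡-1) rewrite A≡-1 = refl

  signed-degrees : ∀ v → d⁺ G v ≡ 3 × d⁻ G v ≡ 2
  signed-degrees v = m+n≡5⇒m-n≡1⇒m≡3∧n≡2 (d⁺ G v) (d⁻ G v)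
                       (trans (sym (d⁺+d⁻≡degree v)) (regular v)) (netRegular v)

  record Neighbourhood (v : Fin n) : Set where
    field
      at        : Fin 5 → Fin n
      sign      : ∀ i → A v (at i) ≡ σ i
      injective : Injective _≡_ _≡_ at
      complete  : ∀ {w} → Adj G v w → ∃[ i ] w ≡ at i

  neighbourhood : ∀ v → Neighbourhood v
  neighbourhood v = record
    { at        = Pos.at ++ Neg.at
    ; sign      = sign ∘ splitAt 3
    ; injective = ++-injective Pos.injective Neg.injective disjoint
    ; complete  = complete
    }
    where
    module Pos = Enumeration (subst (Enumeration (PosEdge G v)) (proj₁ (signed-degrees v))
                                  (enumerate (λ w → A v w ℤ.≟ 1ℤ)))
    module Neg = Enumeration (subst (Enumeration (NegEdge G v)) (proj₂ (signed-degrees v))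
                                  (enumerate (λ w → A v w ℤ.≟ -1ℤ)))
    sign : ∀ s → A v ([ Pos.at , Neg.at ]′ s) ≡ [ (λ _ → 1ℤ) , (λ _ → -1ℤ) ]′ s
    sign (inj₁ p) = Pos.sound p
    sign (inj₂ q) = Neg.sound q
    disjoint : ∀ p q → Pos.at p ≢ Neg.at q
    disjoint p q eq = contradiction (trans (sym (Pos.sound p)) (trans (cong (A v) eq) (Neg.sound q))) λ ()
    complete : ∀ {w} → Adj G v w → ∃[ i ] w ≡ (Pos.at ++ Neg.at) i
    complete {w} v~w with entries v w
    ... | inj₁ A≡0 = contradiction A≡0 v~w
    ... | inj₂ (inj₁ A≡1) =
      let p , w≡p = Pos.complete A≡1 in p ↑ˡ 2 , trans w≡p (sym (lookup-++ˡ Pos.at Neg.at p))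
    ... | inj₂ (inj₂ A≡-1) =
      let q , w≡q = Neg.complete A≡-1 in 3 ↑ʳ q , trans w≡q (sym (lookup-++ʳ Pos.at Neg.at q))

  module N (v : Fin n) = Neighbourhood (neighbourhood v)

  local : Fin n → LocalMatrix
  local v i j = A (N.at v i) (N.at v j)

  ∑-localise : ∀ v (f : Fin n → ℤ) → (∀ w → A v w ≡ 0ℤ → f w ≡ 0ℤ) →
               ∑[ w < n ] f w ≡ ∑[ i < 5 ] f (N.at v i)
  ∑-localise v f vanish = ∑-image (N.at v) (N.injective v) f
    (λ w fw≢0 → N.complete v (fw≢0 ∘ vanish w))

  ∑-A-localise : ∀ v (g : Fin n → ℤ) → ∑[ w < n ] (A v w * g w) ≡ ∑[ i < 5 ] (σ i * g (N.at v i))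
  ∑-A-localise v g =
    trans (∑-localise v (λ w → A v w * g w) (λ w A≡0 → trans (cong (_* g w) A≡0) (ℤ.*-zeroˡ (g w))))
          (sum-cong-≗ (λ i → cong (_* g (N.at v i)) (N.sign v i)))

  column-sum : ∀ x → ∑[ w < n ] A w x ≡ 1ℤ
  column-sum x = begin
    ∑[ w < n ] A w x            ≡⟨ sum-cong-≗ (λ w → trans (A-sym w x) (sym (ℤ.*-identityʳ (A x w)))) ⟩
    ∑[ w < n ] (A x w * 1ℤ)     ≡⟨ ∑-A-localise x (λ _ → 1ℤ) ⟩
    ∑[ i < 5 ] (σ i * 1ℤ)       ∎
    where open ≡-Reasoning

  module StronglyRegular {a b c} (srsg : IsSRSG G 5 a b c) where
    open IsSRSG srsg

    A²-off-diagonal : ∀ {u w} → u ≢ w → A² G u w ≡ param a b c (A u w)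
    A²-off-diagonal {u} {w} u≢w with entries u w
    ... | inj₁ A≡0         rewrite A≡0  = nonAdjPar u w u≢w A≡0
    ... | inj₂ (inj₁ A≡1)  rewrite A≡1  = posPar u w A≡1
    ... | inj₂ (inj₂ A≡-1) rewrite A≡-1 = negPar u w A≡-1

    A²≡param+δ : ∀ u w → A² G u w ≡ param a b c (A u w) + δ u w (+ 5 - c)
    A²≡param+δ u w with u ≟ᶠ w
    ... | yes refl rewrite loopless u = trans (diag u) (5≡c+[5-c] c)
      where
      5≡c+[5-c] : ∀ c → + 5 ≡ c + (+ 5 - c)
      5≡c+[5-c] = solve-∀
    ... | no u≢w = trans (A²-off-diagonal u≢w) (sym (ℤ.+-identityʳ _))

    A·A² : ∀ v x → ∑[ z < n ] (A v z * A² G z x)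
                 ≡ ∑[ z < n ] (A v z * param a b c (A z x)) + A v x * (+ 5 - c)
    A·A² v x = begin
      ∑[ z < n ] (A v z * A² G z x)
        ≡⟨ sum-cong-≗ (λ z → trans (cong (A v z *_) (A²≡param+δ z x))
                                   (ℤ.*-distribˡ-+ (A v z) (param a b c (A z x)) (δ z x k))) ⟩
      ∑[ z < n ] (A v z * param a b c (A z x) + A v z * δ z x k)
        ≡⟨ ∑-distrib-+ (λ z → A v z * param a b c (A z x)) (λ z → A v z * δ z x k) ⟩
      ∑[ z < n ] (A v z * param a b c (A z x)) + ∑[ z < n ] (A v z * δ z x k)
        ≡⟨ cong (λ t → ∑[ z < n ] (A v z * param a b c (A z x)) + t)
                (trans (sum-cong-≗ (λ z → *-δ z x (A v z) k)) (∑-δˡ x (λ z → A v z * k))) ⟩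
      ∑[ z < n ] (A v z * param a b c (A z x)) + A v x * k ∎
      where
      open ≡-Reasoning
      k : ℤ
      k = + 5 - c

    A²·A : ∀ v x → ∑[ w < n ] (A² G v w * A w x)
                 ≡ ∑[ w < n ] (param a b c (A v w) * A w x) + A v x * (+ 5 - c)
    A²·A v x = begin
      ∑[ w < n ] (A² G v w * A w x)
        ≡⟨ sum-cong-≗ (λ w → trans (cong (_* A w x) (A²≡param+δ v w))
                                   (ℤ.*-distribʳ-+ (A w x) (param a b c (A v w)) (δ v w k))) ⟩
      ∑[ w < n ] (param a b c (A v w) * A w x + δ v w k * A w x)
        ≡⟨ ∑-distrib-+ (λ w → param a b c (A v w) * A w x) (λ w → δ v w k * A w x) ⟩
      ∑[ w < n ] (param a b c (A v w) * A w x) + ∑[ w < n ] (δ v w k * A w x)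
        ≡⟨ cong (λ t → ∑[ w < n ] (param a b c (A v w) * A w x) + t)
                (trans (sum-cong-≗ (λ w → δ-* v w k (A w x)))
                       (trans (∑-δ v (λ w → k * A w x)) (ℤ.*-comm k (A v x)))) ⟩
      ∑[ w < n ] (param a b c (A v w) * A w x) + A v x * k ∎
      where
      open ≡-Reasoning
      k : ℤ
      k = + 5 - c

    -- A² is (5 − c)I plus the entrywise image of A under param, so this is A·A² = A²·A with
    -- the multiples of A removed from both sides.
    param-commutes : ∀ v x → ∑[ z < n ] (A v z * param a b c (A z x))
                           ≡ ∑[ w < n ] (param a b c (A v w) * A w x)
    param-commutes v x = ∙-cancelʳ (A v x * (+ 5 - c)) _ _
      (trans (sym (A·A² v x)) (trans (A·A²≡A²·A G v x) (A²·A v x)))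

    ∑-param*A : ∀ v j → let x = N.at v j in
      ∑[ w < n ] (param a b c (A v w) * A w x) ≡ ∑[ i < 5 ] ((param a b c (σ i) - c) * A (N.at v i) x) + c
    ∑-param*A v j = begin
      ∑[ w < n ] (param a b c (A v w) * A w x)
        ≡⟨ sum-cong-≗ (λ w → subtract-c (param a b c (A v w)) c (A w x)) ⟩
      ∑[ w < n ] ((param a b c (A v w) - c) * A w x + c * A w x)
        ≡⟨ ∑-distrib-+ (λ w → (param a b c (A v w) - c) * A w x) (λ w → c * A w x) ⟩
      ∑[ w < n ] ((param a b c (A v w) - c) * A w x) + ∑[ w < n ] (c * A w x)
        ≡⟨ cong₂ _+_ (∑-localise v _ vanish) (sym (*-distribˡ-sum c (λ w → A w x))) ⟩
      ∑[ i < 5 ] ((param a b c (A v (N.at v i)) - c) * A (N.at v i) x) + c * ∑[ w < n ] A w x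
        ≡⟨ cong₂ _+_ (sum-cong-≗ (λ i → cong (λ t → (param a b c t - c) * A (N.at v i) x)
                                              (N.sign v i)))
                     (trans (cong (c *_) (column-sum x)) (ℤ.*-identityʳ c)) ⟩
      ∑[ i < 5 ] ((param a b c (σ i) - c) * A (N.at v i) x) + c ∎
      where
      open ≡-Reasoning
      x : Fin n
      x = N.at v j
      subtract-c : ∀ p c s → p * s ≡ (p - c) * s + c * s
      subtract-c = solve-∀
      vanish : ∀ w → A v w ≡ 0ℤ → (param a b c (A v w) - c) * A w x ≡ 0ℤ
      vanish w A≡0 = trans (cong (λ t → (param a b c t - c) * A w x) A≡0)
                           (trans (cong (_* A w x) (ℤ.+-inverseʳ c)) (ℤ.*-zeroˡ (A w x)))

    column-equation : ∀ v j → column (local v) j ≡ bySign a b j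
    column-equation v j = begin
      column (local v) j                      ≡⟨ sym (∑-A-localise v (λ z → A z x)) ⟩
      ∑[ z < n ] (A v z * A z x)              ≡⟨ sym (sumℤ≡∑ n _) ⟩
      A² G v x                                ≡⟨ A²-neighbour (bySign-cases a b j) ⟩
      bySign a b j                            ∎
      where
      open ≡-Reasoning
      x : Fin n
      x = N.at v j
      A²-neighbour : σ j ≡ 1ℤ × bySign a b j ≡ a ⊎ σ j ≡ -1ℤ × bySign a b j ≡ b →
                     A² G v x ≡ bySign a b j
      A²-neighbour (inj₁ (σj≡1 , a≡)) = trans (posPar v x (trans (N.sign v j) σj≡1)) (sym a≡)
      A²-neighbour (inj₂ (σj≡-1 , b≡)) = trans (negPar v x (trans (N.sign v j) σj≡-1)) (sym b≡)

    balance-equation : a + b ≢ + 2 * c → ∀ v j → balance (local v) j ≡ 0ℤ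
    balance-equation a+b≢2c v j =
      balance≡0 a b c (local v) j a+b≢2c (λ i → entry∈entryValues G _ _)
        (trans (sym (∑-A-localise v (λ z → param a b c (A z (N.at v j)))))
               (trans (param-commutes v (N.at v j)) (∑-param*A v j)))

    localFacts : a + b ≢ + 2 * c → ∀ v → LocalFacts a b (local v)
    localFacts a+b≢2c v =
      classify a b (local v) (λ i j → entry∈entryValues G _ _) (λ i j → A-sym _ _) (λ i → loopless _)
               (column-equation v) (balance-equation a+b≢2c v)

    module Nondegenerate (a+b≢2c : a + b ≢ + 2 * c) where
      private
        module F v = LocalFacts (localFacts a+b≢2c v)

      positive-edge-isolated : a ≡ 0ℤ → ∀ u w → PosEdge G u w → ¬ HaveCommonNeighbour G u w
      positive-edge-isolated a≡0 u w u+w (k , u~k , w~k)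
        with N.complete u (PosEdge⇒Adj G u+w) | N.complete u u~k
      ... | i , refl | l , refl =
        w~k (F.positive-rows-vanish u a≡0 i l (trans (sym (N.sign u i)) u+w))

      negative-edge-isolated : b ≡ 0ℤ → ∀ u w → NegEdge G u w → ¬ HaveCommonNeighbour G u w
      negative-edge-isolated b≡0 u w u-w (k , u~k , w~k)
        with N.complete u (NegEdge⇒Adj G u-w) | N.complete u u~k
      ... | i , refl | l , refl =
        w~k (F.negative-rows-vanish u b≡0 i l (trans (sym (N.sign u i)) u-w))

      negative-neighbours-joined : b ≡ 1ℤ ⊎ b ≡ + 4 → ∀ {u w₁ w₂} →
        NegEdge G u w₁ → NegEdge G u w₂ → w₁ ≢ w₂ → NegEdge G w₁ w₂
      negative-neighbours-joined b∈ {u} u-w₁ u-w₂ w₁≢w₂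
        with N.complete u (NegEdge⇒Adj G u-w₁) | N.complete u (NegEdge⇒Adj G u-w₂)
      ... | i , refl | j , refl
        with σ-negative {i} (trans (sym (N.sign u i)) u-w₁) | σ-negative {j} (trans (sym (N.sign u j)) u-w₂)
      ... | inj₁ refl | inj₁ refl = contradiction refl w₁≢w₂
      ... | inj₁ refl | inj₂ refl = F.negative-pair-joined u b∈
      ... | inj₂ refl | inj₁ refl = trans (A-sym _ _) (F.negative-pair-joined u b∈)
      ... | inj₂ refl | inj₂ refl = contradiction refl w₁≢w₂

      positive-neighbour-flips-sign : a ≡ -[1+ 3 ] → ∀ {u w₁ w₂} →
        PosEdge G u w₁ → Adj G u w₂ → w₁ ≢ w₂ → A w₁ w₂ ≡ - A u w₂
      positive-neighbour-flips-sign a≡-4 {u} u+w₁ u~w₂ w₁≢w₂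
        with N.complete u (PosEdge⇒Adj G u+w₁) | N.complete u u~w₂
      ... | i , refl | j , refl =
        trans (F.opposite-signs u a≡-4 i j (trans (sym (N.sign u i)) u+w₁) (w₁≢w₂ ∘ cong (N.at u)))
              (cong -_ (sym (N.sign u j)))

      -- y₃ and y₄ are positive neighbours of y₀, so that the local picture at y₀ forces a negative
      -- edge y₃y₄, whereas the one at v forbids it.
      ¬[-4,3] : Fin n → a ≡ -[1+ 3 ] → b ≢ + 3
      ¬[-4,3] v a≡-4 b≡3 =
        contradiction (trans (sym (F.negative-pair-unjoined v b≡3)) y₃-y₄) λ ()
        where
        open N v
        y₀+y : ∀ k → σ k ≡ -1ℤ → 0F ≢ k → PosEdge G (at 0F) (at k)
        y₀+y k σk≡-1 0≢k =
          trans (positive-neighbour-flips-sign a≡-4 (sign 0F) (NegEdge⇒Adj G (trans (sign k) σk≡-1)) (0≢k ∘ injective {0F} {k}))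
                (cong -_ (trans (sign k) σk≡-1))
        y₃-y₄ : NegEdge G (at 3F) (at 4F)
        y₃-y₄ = trans (positive-neighbour-flips-sign a≡-4 (y₀+y 3F refl λ ()) (PosEdge⇒Adj G (y₀+y 4F refl λ ()))
                                     (λ y₃≡y₄ → contradiction (injective {3F} {4F} y₃≡y₄) λ ()))
                      (cong -_ (y₀+y 4F refl λ ()))

      ¬[-4,4] : Connected G → ¬ Complete G → a ≡ -[1+ 3 ] → b ≢ + 4
      ¬[-4,4] connected ¬complete a≡-4 b≡4 =
        ¬complete (connected-locally-complete⇒complete G connected clique)
        where
        nonzero : ∀ {x y} → x ≡ - y → y ≢ 0ℤ → x ≢ 0ℤ
        nonzero x≡-y y≢0 x≡0 = y≢0 (ℤ.neg-injective (trans (sym x≡-y) x≡0))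
        clique : LocallyComplete G
        clique {u} {w₁} {w₂} u~w₁ u~w₂ w₁≢w₂ with entries u w₁ | entries u w₂
        ... | inj₁ A≡0 | _ = contradiction A≡0 u~w₁
        ... | _ | inj₁ A≡0 = contradiction A≡0 u~w₂
        ... | inj₂ (inj₁ u+w₁) | _ = nonzero (positive-neighbour-flips-sign a≡-4 u+w₁ u~w₂ w₁≢w₂) u~w₂
        ... | _ | inj₂ (inj₁ u+w₂) =
          Adj-sym G (nonzero (positive-neighbour-flips-sign a≡-4 u+w₂ u~w₁ (w₁≢w₂ ∘ sym)) u~w₁)
        ... | inj₂ (inj₂ u-w₁) | inj₂ (inj₂ u-w₂) =
          NegEdge⇒Adj G (negative-neighbours-joined (inj₂ b≡4) u-w₁ u-w₂ w₁≢w₂)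

      ¬balanced-triangle : b ≡ 1ℤ → ¬ BalancedTriangleTwoNeg G
      ¬balanced-triangle b≡1 (i , j , k , i-j , j-k , i+k) =
        contradiction (trans (sym i+k) (negative-neighbours-joined (inj₁ b≡1) (trans (A-sym j i) i-j) j-k i≢k))
                      λ ()
        where
        i≢k : i ≢ k
        i≢k refl = contradiction (trans (sym i+k) (loopless i)) λ ()

admissible⇒realised : ∀ {a b} → (a , b) ∈ admissiblePairs →
  (a ≡ -[1+ 3 ] → b ≢ + 3) → (a ≡ -[1+ 3 ] → b ≢ + 4) → (a , b) ∈ realisedPairs
admissible⇒realised (here refl)         ¬[-4,3] _       = contradiction refl (¬[-4,3] refl)
admissible⇒realised (there (here refl)) _       ¬[-4,4] = contradiction refl (¬[-4,4] refl)
admissible⇒realised (there (there p))   _       _       = p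

Consequences : ℤ → ℤ → Set
Consequences a b =
  a < + 3 × (a ≡ -[1+ 0 ] → b ≤ + 0) × (a ≡ -[1+ 1 ] → -[1+ 0 ] ≤ b) × -[1+ 2 ] < a
  × (-[1+ 1 ] ≤ b × b < + 3) × (b ≤ + 0 ⊎ b ≡ 1ℤ)
  × (b ≡ + 2 ⊎ b ≡ -[1+ 0 ] → a ≤ + 0) × (b ≡ -[1+ 1 ] → + 1 ≤ a)

consequences : All (uncurry Consequences) realisedPairs
consequences = from-yes (All.all? (λ (a , b) →
  a ℤ.<? + 3 ×-dec (a ℤ.≟ -[1+ 0 ] →-dec b ℤ.≤? + 0) ×-dec (a ℤ.≟ -[1+ 1 ] →-dec -[1+ 0 ] ℤ.≤? b)
  ×-dec -[1+ 2 ] ℤ.<? a ×-dec (-[1+ 1 ] ℤ.≤? b ×-dec b ℤ.<? + 3) ×-dec (b ℤ.≤? + 0 ⊎-dec b ℤ.≟ 1ℤ)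
  ×-dec ((b ℤ.≟ + 2 ⊎-dec b ℤ.≟ -[1+ 0 ]) →-dec a ℤ.≤? + 0) ×-dec (b ℤ.≟ -[1+ 1 ] →-dec + 1 ℤ.≤? a))
  realisedPairs)

nondegenerate : ∀ {n} {G : SignedGraph n} {a b c} → InC₁ G a b c ⊎ InC₄ G a b c ⊎ InC₅ G a b c →
                ¬ Complete G → a + b ≢ + 2 * c
nondegenerate (inj₁ (_ , _ , inj₁ complete)) ¬complete _ = ¬complete complete
nondegenerate {b = b} (inj₁ (_ , refl , inj₂ (_ , c≢0))) _ a+b≡2c =
  c≢0 ([ (λ ()) , id ]′ (ℤ.i*j≡0⇒i≡0∨j≡0 (+ 2) (trans (sym a+b≡2c) (ℤ.+-inverseˡ b))))
nondegenerate {a = a} {b} (inj₂ (inj₁ (_ , a≢-b , _ , refl))) _ a+b≡0 = a≢-b (inverseˡ-unique a b a+b≡0)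
nondegenerate (inj₂ (inj₂ (_ , _ , _ , 2c≢a+b , _))) _ a+b≡2c = 2c≢a+b (sym a+b≡2c)

proposition3p4 :
    (n : ℕ) (G : SignedGraph n) (a b c : ℤ) →
    (InC₁ G a b c ⊎ InC₄ G a b c ⊎ InC₅ G a b c) →
    Connected G → ¬ Complete G → Regular G 5 → NetRegular G (+ 1) →
    IsSRSG G 5 a b c →
    (a < + 3)
    × ((a ≡ + 0 → ∀ i j → PosEdge G i j → ¬ HaveCommonNeighbour G i j)
       × (b ≡ + 0 → ∀ i j → NegEdge G i j → ¬ HaveCommonNeighbour G i j))
    × (a ≡ -[1+ 0 ] → b ≤ + 0)
    × (a ≡ -[1+ 1 ] → -[1+ 0 ] ≤ b)
    × (-[1+ 2 ] < a)
    × (-[1+ 1 ] ≤ b × b < + 3)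
    × (BalancedTriangleTwoNeg G → b ≤ + 0)
    × (b ≡ + 2 ⊎ b ≡ -[1+ 0 ] → a ≤ + 0)
    × (b ≡ -[1+ 1 ] → + 1 ≤ a)
proposition3p4 zero G a b c _ _ ¬complete _ _ _ = contradiction (λ ()) ¬complete
proposition3p4 (suc n) G a b c class connected ¬complete regular netRegular srsg =
  let a<3 , a≡-1⇒ , a≡-2⇒ , -3<a , b-range , b≤0⊎b≡1 , b∈⇒ , b≡-2⇒ =
        All.lookup consequences realised
  in  a<3 , (positive-edge-isolated , negative-edge-isolated) , a≡-1⇒ , a≡-2⇒ , -3<a , b-range
      , (λ triangle → [ id , (λ b≡1 → contradiction triangle (¬balanced-triangle b≡1)) ]′ b≤0⊎b≡1)
      , b∈⇒ , b≡-2⇒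
  where
  open Regular5NetRegular1 G regular netRegular
  open StronglyRegular srsg
  a+b≢2c : a + b ≢ + 2 * c
  a+b≢2c = nondegenerate {G = G} {a} {b} {c} class ¬complete
  open Nondegenerate a+b≢2c
  realised : (a , b) ∈ realisedPairs
  realised = admissible⇒realised (LocalFacts.admissible (localFacts a+b≢2c zero))
                                 (¬[-4,3] zero) (¬[-4,4] connected ¬complete)
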